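{- Let $X$ be a set of $n$ cards, $a,b$ positive integers with $a+b+1=n$, and let $t\ge 2$. Suppose Alice uses an equitable $(a,b,1)$-strategy in which each announcement $\mathcal{A}_i$ is the block set of a $t$-$(n,a,\lambda)$-design on $X$. Then the strategy is perfectly $(t-1)$-secure against Cathy.
   Context: An $(a,b,c)$-deal is a uniformly random partition of $X$ into Alice's hand $H_A$ ($a$ cards), Bob's hand $H_B$ ($b$ cards) and Cathy's hand $H_C$ ($c$ cards); here $c=1$. An announcement is a set of $a$-subsets of $X$. An $(a,b,c)$-strategy consists of announcements $\mathcal{A}_1,\dots,\mathcal{A}_m$ covering all $a$-subsets of $X$ together with, for each $H_A$, a probability distribution $p_{H_A}$ with positive values on $g(H_A)=\{i : H_A\in\mathcal{A}_i\}$; Alice broadcasts an index $i$ chosen according to $p_{H_A}$. It is equitable if there is $\gamma$ with $|g(H_A)|=\gamma$ for all $H_A$ and every $p_{H_A}$ uniform. For $H\subseteq X$, $\mathcal{P}(H,i)=\{H_A\in\mathcal{A}_i : H_A\cap H=\emptyset\}$. For $1\le\delta\le a$, the strategy is perfectly $\delta$-secure against Cathy if for every $\delta'$ with $1\le\delta'\le\delta$, every $i$, every $c$-subset $H_C$ with $\mathcal{P}(H_C,i)\neq\emptyset$ and all distinct $x_1,\dots,x_{\delta'}\in X\setminus H_C$, $\Pr[x_1,\dots,x_{\delta'}\in H_A\mid i,H_C]=\binom{a}{\delta'}/\binom{a+b}{\delta'}$ (probability over the deal and Alice's choice). A $t$-$(v,k,\lambda)$-design ($t\le k<v$) is a pair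 $(X,\mathcal{B})$ with $|X|=v$, $\mathcal{B}$ a multiset of $k$-subsets (blocks), such that every $t$-subset of $X$ lies in exactly $\lambda$ blocks. -}

module Defs where

open import Data.Nat as ℕ using (ℕ; zero; suc; _≤_; _<_)
open import Data.Nat.Combinatorics using (_C_)
open import Data.Bool using (Bool; true; false; if_then_else_; _∧_)
open import Data.Integer using (+_)
open import Data.Rational as ℚ using (ℚ; 0ℚ; 1ℚ; _/_; _÷_; _*_; _+_; _>_)
open import Data.Rational.Properties using () renaming (_≟_ to _≟ℚ_)
open import Data.Fin using (Fin)
open import Data.Fin.Subset using (Subset; ∣_∣; _⊆_; _∩_; _∉_; ⊥; ∁)
open import Data.Fin.Subset.Properties using (_⊆?_)
open import Data.Vec using (Vec; []; _∷_; lookup)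
open import Data.List as List using (List; []; _∷_; allFin; foldr; map; length; filterᵇ; concatMap)
open import Data.Product using (Σ; _×_; _,_; ∃)
open import Function.Definitions using (Injective)
open import Relation.Binary.PropositionalEquality using (_≡_)
open import Relation.Nullary using (yes; no; does)

allSubsets : (n : ℕ) → List (Subset n)
allSubsets zero    = [] ∷ []
allSubsets (suc n) = concatMap (λ s → (true ∷ s) ∷ (false ∷ s) ∷ []) (allSubsets n)

count : ∀ {A : Set} → (A → Bool) → List A → ℕ
count p xs = length (filterᵇ p xs)

Σℚ : ∀ {A : Set} → List A → (A → ℚ) → ℚ
Σℚ xs f = foldr _+_ 0ℚ (map f xs)

ℕ→ℚ : ℕ → ℚ
ℕ→ℚ k = + k / 1

-- division returning 0 when the denominator is 0 (only used where
-- the denominator is in fact nonzero)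
_÷?_ : ℚ → ℚ → ℚ
p ÷? q with q ≟ℚ 0ℚ
... | yes _ = 0ℚ
... | no q≢0 = _÷_ p q {{ℚ.≢-nonZero q≢0}}

_⊆ᵇ_ : ∀ {n} → Subset n → Subset n → Bool
S ⊆ᵇ T = does (S ⊆? T)

_==_ : ℕ → ℕ → Bool
m == k = does (m ℕ.≟ k)

disjointᵇ : ∀ {n} → Subset n → Subset n → Bool
disjointᵇ S T = (S ∩ T) ⊆ᵇ ⊥

-- t-(v,k,λ)-designs.  An announcement is a *set* of subsets of X = Fin v,
-- represented by its characteristic function; hence the design is simple
-- (each block occurs once).

record IsDesign (t v k lam : ℕ) (B : Subset v → Bool) : Set where
  field
    t≤k       : t ≤ k
    k<v       : k < v
    blockSize : ∀ S → B S ≡ true → ∣ S ∣ ≡ k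
    balanced  : ∀ (T : Subset v) → ∣ T ∣ ≡ t →
                count (λ S → B S ∧ (T ⊆ᵇ S)) (allSubsets v) ≡ lam

record Strategy (n a m : ℕ) : Set where
  field
    𝒜        : Fin m → Subset n → Bool
    𝒜-size   : ∀ i S → 𝒜 i S ≡ true → ∣ S ∣ ≡ a
    covers   : ∀ (H : Subset n) → ∣ H ∣ ≡ a → ∃ λ i → 𝒜 i H ≡ true
    p        : Subset n → Fin m → ℚ
    p-pos    : ∀ H i → ∣ H ∣ ≡ a → 𝒜 i H ≡ true → p H i > 0ℚ
    p-zero   : ∀ H i → ∣ H ∣ ≡ a → 𝒜 i H ≡ false → p H i ≡ 0ℚ
    p-sum    : ∀ H → ∣ H ∣ ≡ a → Σℚ (allFin m) (p H) ≡ 1ℚ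

open Strategy public

gSize : ∀ {n a m} → Strategy n a m → Subset n → ℕ
gSize {m = m} σ H = count (λ i → 𝒜 σ i H) (allFin m)

Equitable : ∀ {n a m} → Strategy n a m → Set
Equitable {n} {a} σ =
  Σ ℕ λ γ →
    (∀ H → ∣ H ∣ ≡ a → gSize σ H ≡ γ) ×
    (∀ H i j → ∣ H ∣ ≡ a → 𝒜 σ i H ≡ true → 𝒜 σ j H ≡ true → p σ H i ≡ p σ H j)

-- A deal is (H_A, H_B, H_C) with H_B = X \ (H_A ∪ H_C),
-- so it is determined by the pair (H_A, H_C) of disjoint subsets of sizes
-- a and c (b = n - a - c).  Deals are uniform; then Alice announces i
-- with probability p_{H_A}(i).

validDeal : ∀ {n} (a c : ℕ) → Subset n → Subset n → Bool
validDeal a c HA HC = (∣ HA ∣ == a) ∧ (∣ HC ∣ == c) ∧ disjointᵇ HA HC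

sumℕ : ∀ {A : Set} → List A → (A → ℕ) → ℕ
sumℕ xs f = foldr ℕ._+_ 0 (map f xs)

numDeals : (n a c : ℕ) → ℕ
numDeals n a c =
  sumℕ (allSubsets n) λ HA → count (λ HC → validDeal a c HA HC) (allSubsets n)

dealProb : ∀ {n} (a c : ℕ) → Subset n → Subset n → ℚ
dealProb {n} a c HA HC =
  if validDeal a c HA HC then 1ℚ ÷? ℕ→ℚ (numDeals n a c) else 0ℚ

PrJoint : ∀ {n a m} → Strategy n a m → (c : ℕ) →
          (Subset n → Bool) → Fin m → Subset n → ℚ
PrJoint {n} {a} σ c E i HC =
  Σℚ (allSubsets n) λ HA →
    if E HA then dealProb a c HA HC * p σ HA i else 0ℚ

PrCond : ∀ {n a m} → Strategy n a m → (c : ℕ) →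
         (Subset n → Bool) → Fin m → Subset n → ℚ
PrCond σ c E i HC = PrJoint σ c E i HC ÷? PrJoint σ c (λ _ → true) i HC

allIn : ∀ {n δ'} → (Fin δ' → Fin n) → Subset n → Bool
allIn {δ' = δ'} xs HA = foldr _∧_ true (map (λ k → lookup HA (xs k)) (allFin δ'))

PerfectlySecure : ∀ {n a m} → Strategy n a m → (b c δ : ℕ) → Set
PerfectlySecure {n} {a} {m} σ b c δ =
  ∀ (δ' : ℕ) → 1 ≤ δ' → δ' ≤ δ →
  ∀ (i : Fin m) (HC : Subset n) → ∣ HC ∣ ≡ c →
  (∃ λ HA → (𝒜 σ i HA ≡ true) × (disjointᵇ HA HC ≡ true)) →
  ∀ (xs : Fin δ' → Fin n) → Injective _≡_ _≡_ xs → (∀ k → xs k ∉ HC) →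
  PrCond σ c (allIn xs) i HC ≡ ℕ→ℚ (a C δ') ÷? ℕ→ℚ ((a ℕ.+ b) C δ')

-- Fix Cathy's card h. Equitability gives every hand of the announced design 𝒜ᵢ the same
-- chance 1/γ of announcing i, and all deals are equally likely, so conditioned on i and h,
-- Alice's hand is uniform among the blocks of 𝒜ᵢ avoiding h. The conditional probability
-- that x₁, …, x_δ lie in her hand is therefore ν(X)/ν(∅), where ν(T) counts the blocks
-- through T avoiding h. A t-design is an s-design for every s ≤ t, and ν(T) = μ_s − μ_{s+1}
-- for |T| = s < t, so ν depends only on |T| below t. Double counting the pairs (x, B) with
-- x ∈ B ∖ T gives ν_s (k − s) = (n − 1 − s) ν_{s+1}, which telescopes to
-- ν_δ / ν_0 = C(k, δ) / C(n − 1, δ) = C(a, δ) / C(a + b, δ).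

module Submission where

open import Algebra.Bundles using (CommutativeMonoid)
import Algebra.Properties.CommutativeSemigroup as CommSemigroupProperties
open import Data.Bool using (Bool; T; true; false; if_then_else_; _∧_; _∨_; not)
open import Data.Bool.Properties using (∧-zeroʳ; ∧-identityʳ; ∧-comm; ∨-zeroʳ; ∨-identityʳ)
open import Data.Fin using (Fin; zero; suc)
import Data.Fin.Properties as Finₚ
open import Data.Fin.Subset using (Subset; ∣_∣; _∈_; _∉_; _∪_; _∩_; ∁; ⁅_⁆; ⊥)
open import Data.Fin.Subset.Properties
  using (∣⁅x⁆∣≡1; x∈⁅x⁆; ∣⊥∣≡0; ∉⊥; ∣∁p∣≡n∸∣p∣; ∪-identityʳ; x∈p∪q⁻; x∉⁅y⁆⇒x≢y; x∈⁅y⁆⇒x≡y;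
         drop-not-there)
import Data.Integer as ℤ
import Data.Integer.Properties as ℤₚ
open import Data.List using (List; []; _∷_; allFin; tabulate; foldr; map)
open import Data.List.Membership.Propositional using () renaming (_∈_ to _∈ˡ_)
open import Data.List.Membership.Propositional.Properties using (∈-concatMap⁺)
open import Data.List.Properties using (map-tabulate)
import Data.List.Relation.Unary.Any as Any
open import Data.Nat
  using (ℕ; zero; suc; _+_; _*_; _∸_; _!; _≤_; _<_; _≟_; _<?_; s≤s; _≤‴_; ≤‴-refl; ≤‴-step;
         NonZero; >-nonZero; ≢-nonZero⁻¹)
open import Data.Nat.Combinatorics
  using (_C_; nCk≡n!/k![n-k]!; k![n∸k]!∣n!; k>n⇒nCk≡0; [n-k]*d[k+1]≡[k+1]*d[k])
open import Data.Nat.Coprimality using (1-coprimeTo) renaming (sym to Coprime-sym)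
open import Data.Nat.DivMod using (_/_; m*n/n≡m; m/n*n≡m)
open import Data.Nat.Properties
  using (suc-injective; ≡ᵇ⇒≡; +-suc; +-comm; m+n∸n≡m; m+n≡0⇒m≡0; m+n≡0⇒n≡0; ∸-+-assoc;
         m<n⇒0<n∸m; m≤n⇒m∸n≡0; *-comm; *-assoc; *-zeroʳ; *-identityʳ; *-cancelʳ-≡; ≤-refl;
         ≤-trans; <⇒≤; <-≤-trans; ≤-<-trans; m≤m+n; m≤n⇒m≤1+n; ≮⇒≥; ≤⇒≤‴; ≤‴⇒≤; _!≢0;
         _!*_!≢0; +-commutativeSemigroup; *-commutativeSemigroup)
open import Data.Product using (∃; _,_; proj₁; proj₂)
open import Data.Rational as ℚ using (ℚ; mkℚ; 0ℚ; 1ℚ; 1/_)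
open import Data.Rational.Properties using (↥p/↧p≡p) renaming (_≟_ to _≟ℚ_)
import Data.Rational.Properties as ℚₚ
open import Data.Sum using (inj₁; inj₂)
open import Data.Vec using (_∷_; []; lookup; here)
open import Data.Vec.Properties
  using (lookup-map; lookup-zipWith; lookup-replicate; lookup⇒[]=; []=⇒lookup)
open import Function using (_∘_; case_of_)
open import Function.Definitions using (Injective)
open import Relation.Binary.PropositionalEquality
open import Relation.Nullary using (contradiction; yes; no)
open import Relation.Nullary.Decidable using (dec-true)

open import Defs

private
  module ℕ*ₚ = CommSemigroupProperties *-commutativeSemigroup
  module ℚ*ₚ = CommSemigroupProperties (CommutativeMonoid.commutativeSemigroup ℚₚ.*-1-commutativeMonoid)

toℕ : Bool → ℕ
toℕ b = if b then 1 else 0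

module _ {A : Set} where

  count-∷ : (p : A → Bool) (x : A) (xs : List A) → count p (x ∷ xs) ≡ toℕ (p x) + count p xs
  count-∷ p x xs with p x
  ... | true  = refl
  ... | false = refl

  count-cong : {p q : A → Bool} (xs : List A) → (∀ x → p x ≡ q x) → count p xs ≡ count q xs
  count-cong [] _ = refl
  count-cong {p} {q} (x ∷ xs) p≗q
    rewrite count-∷ p x xs | count-∷ q x xs | p≗q x | count-cong xs p≗q = refl

  count-false : (xs : List A) → count (λ _ → false) xs ≡ 0
  count-false [] = refl
  count-false (_ ∷ xs) = count-false xs

  count-split : (p q : A → Bool) (xs : List A) →
                count p xs ≡ count (λ x → p x ∧ q x) xs + count (λ x → p x ∧ not (q x)) xs
  count-split p q [] = refl
  count-split p q (x ∷ xs) with p x | q x | count-split p q xs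
  ... | true  | true  | ih = cong suc ih
  ... | true  | false | ih = trans (cong suc ih) (sym (+-suc _ _))
  ... | false | _     | ih = ih

  sumℕ-cong : {f g : A → ℕ} (xs : List A) → (∀ x → f x ≡ g x) → sumℕ xs f ≡ sumℕ xs g
  sumℕ-cong [] _ = refl
  sumℕ-cong (x ∷ xs) f≗g = cong₂ _+_ (f≗g x) (sumℕ-cong xs f≗g)

  sumℕ-indicator : (p : A → Bool) (m : ℕ) (xs : List A) →
                   sumℕ xs (λ x → if p x then m else 0) ≡ count p xs * m
  sumℕ-indicator p m [] = refl
  sumℕ-indicator p m (x ∷ xs) with p x
  ... | true  = cong (m +_) (sumℕ-indicator p m xs)
  ... | false = sumℕ-indicator p m xs

  count≡sumℕ : (p : A → Bool) (xs : List A) → count p xs ≡ sumℕ xs (toℕ ∘ p)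
  count≡sumℕ p xs = sym (trans (sumℕ-indicator p 1 xs) (*-identityʳ _))

sumℕ-+ : ∀ {A : Set} (f g : A → ℕ) (xs : List A) →
         sumℕ xs (λ x → f x + g x) ≡ sumℕ xs f + sumℕ xs g
sumℕ-+ f g [] = refl
sumℕ-+ f g (x ∷ xs) =
  trans (cong (f x + g x +_) (sumℕ-+ f g xs)) (interchange (f x) (g x) (sumℕ xs f) (sumℕ xs g))
  where open CommSemigroupProperties +-commutativeSemigroup using (interchange)

sumℕ-zero : ∀ {A : Set} (xs : List A) → sumℕ xs (λ _ → 0) ≡ 0
sumℕ-zero [] = refl
sumℕ-zero (_ ∷ xs) = sumℕ-zero xs

sumℕ-swap : ∀ {A B : Set} (xs : List A) (ys : List B) (f : A → B → ℕ) →
            sumℕ xs (λ x → sumℕ ys (f x)) ≡ sumℕ ys (λ y → sumℕ xs (λ x → f x y))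
sumℕ-swap [] ys f = sym (sumℕ-zero ys)
sumℕ-swap (x ∷ xs) ys f =
  trans (cong (sumℕ ys (f x) +_) (sumℕ-swap xs ys f)) (sym (sumℕ-+ (f x) _ ys))

count-tabulate : ∀ {A : Set} {n} (p : A → Bool) (f : Fin n → A) →
                 count p (tabulate f) ≡ count (p ∘ f) (allFin n)
count-tabulate {n = zero} p f = refl
count-tabulate {n = suc n} p f
  rewrite count-∷ p (f zero) (tabulate (f ∘ suc)) | count-∷ (p ∘ f) zero (tabulate suc)
        | count-tabulate p (f ∘ suc) | count-tabulate (p ∘ f) suc = refl

count-lookup : ∀ {n} (P : Subset n) → count (lookup P) (allFin n) ≡ ∣ P ∣
count-lookup [] = refl
count-lookup (b ∷ P)
  rewrite count-∷ (lookup (b ∷ P)) zero (tabulate suc) | count-tabulate (lookup (b ∷ P)) suc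
        | count-lookup P with b
... | true  = refl
... | false = refl

count-∉ : ∀ {n} (S : Subset n) → count (λ x → not (lookup S x)) (allFin n) ≡ n ∸ ∣ S ∣
count-∉ {n} S = begin
  count (λ x → not (lookup S x)) (allFin n) ≡⟨ count-cong (allFin n) (λ x → sym (lookup-map x not S)) ⟩
  count (lookup (∁ S)) (allFin n)           ≡⟨ count-lookup (∁ S) ⟩
  ∣ ∁ S ∣                                   ≡⟨ ∣∁p∣≡n∸∣p∣ S ⟩
  n ∸ ∣ S ∣                                 ∎
  where open ≡-Reasoning

⊥⊆ᵇ : ∀ {n} (B : Subset n) → ⊥ ⊆ᵇ B ≡ true
⊥⊆ᵇ [] = refl
⊥⊆ᵇ (_ ∷ B) = ⊥⊆ᵇ B

∪⁅⁆⊆ᵇ : ∀ {n} (x : Fin n) (S B : Subset n) → (S ∪ ⁅ x ⁆) ⊆ᵇ B ≡ lookup B x ∧ S ⊆ᵇ B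
∪⁅⁆⊆ᵇ zero (s ∷ S) (b ∷ B) rewrite ∨-zeroʳ s | ∪-identityʳ S with s | b
... | _     | false = refl
... | true  | true  = refl
... | false | true  = refl
∪⁅⁆⊆ᵇ (suc x) (s ∷ S) (b ∷ B) rewrite ∨-identityʳ s with s | b
... | false | _     = ∪⁅⁆⊆ᵇ x S B
... | true  | true  = ∪⁅⁆⊆ᵇ x S B
... | true  | false = sym (∧-zeroʳ (lookup B x))

∣∪⁅⁆∣ : ∀ {n} {x : Fin n} (S : Subset n) → x ∉ S → ∣ S ∪ ⁅ x ⁆ ∣ ≡ suc ∣ S ∣
∣∪⁅⁆∣ {x = zero} (true ∷ S) x∉S = contradiction here x∉S
∣∪⁅⁆∣ {x = zero} (false ∷ S) _ = cong (suc ∘ ∣_∣) (∪-identityʳ S)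
∣∪⁅⁆∣ {x = suc x} (s ∷ S) x∉S rewrite ∨-identityʳ s with s
... | true  = cong suc (∣∪⁅⁆∣ S (drop-not-there x∉S))
... | false = ∣∪⁅⁆∣ S (drop-not-there x∉S)

∣∁S∩B∣+∣S∣≡∣B∣ : ∀ {n} (S B : Subset n) → S ⊆ᵇ B ≡ true → ∣ ∁ S ∩ B ∣ + ∣ S ∣ ≡ ∣ B ∣
∣∁S∩B∣+∣S∣≡∣B∣ [] [] _ = refl
∣∁S∩B∣+∣S∣≡∣B∣ (true ∷ S) (true ∷ B) S⊆B = trans (+-suc _ _) (cong suc (∣∁S∩B∣+∣S∣≡∣B∣ S B S⊆B))
∣∁S∩B∣+∣S∣≡∣B∣ (false ∷ S) (true ∷ B) S⊆B = cong suc (∣∁S∩B∣+∣S∣≡∣B∣ S B S⊆B)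
∣∁S∩B∣+∣S∣≡∣B∣ (false ∷ S) (false ∷ B) S⊆B = ∣∁S∩B∣+∣S∣≡∣B∣ S B S⊆B

∣S∣≡0⇒S≡⊥ : ∀ {n} (S : Subset n) → ∣ S ∣ ≡ 0 → S ≡ ⊥
∣S∣≡0⇒S≡⊥ [] _ = refl
∣S∣≡0⇒S≡⊥ (false ∷ S) ∣S∣≡0 = cong (false ∷_) (∣S∣≡0⇒S≡⊥ S ∣S∣≡0)

∣S∣≡1⇒S≡⁅x⁆ : ∀ {n} (S : Subset n) → ∣ S ∣ ≡ 1 → ∃ λ x → S ≡ ⁅ x ⁆
∣S∣≡1⇒S≡⁅x⁆ (true ∷ S) ∣S∣≡1 = zero , cong (true ∷_) (∣S∣≡0⇒S≡⊥ S (suc-injective ∣S∣≡1))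
∣S∣≡1⇒S≡⁅x⁆ (false ∷ S) ∣S∣≡1 with ∣S∣≡1⇒S≡⁅x⁆ S ∣S∣≡1
... | x , refl = suc x , refl

disjointᵇ-⊥ : ∀ {n} (B : Subset n) → disjointᵇ B ⊥ ≡ true
disjointᵇ-⊥ [] = refl
disjointᵇ-⊥ (true ∷ B) = disjointᵇ-⊥ B
disjointᵇ-⊥ (false ∷ B) = disjointᵇ-⊥ B

disjointᵇ-⁅⁆ : ∀ {n} (B : Subset n) (h : Fin n) → disjointᵇ B ⁅ h ⁆ ≡ not (lookup B h)
disjointᵇ-⁅⁆ (true ∷ B) zero = refl
disjointᵇ-⁅⁆ (false ∷ B) zero = disjointᵇ-⊥ B
disjointᵇ-⁅⁆ (true ∷ B) (suc h) = disjointᵇ-⁅⁆ B h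
disjointᵇ-⁅⁆ (false ∷ B) (suc h) = disjointᵇ-⁅⁆ B h

image : ∀ {δ n} → (Fin δ → Fin n) → Subset n
image {zero} xs = ⊥
image {suc δ} xs = image (xs ∘ suc) ∪ ⁅ xs zero ⁆

∈-image⁻ : ∀ {δ n} (xs : Fin δ → Fin n) {y} → y ∈ image xs → ∃ λ k → xs k ≡ y
∈-image⁻ {zero} xs y∈ = contradiction y∈ ∉⊥
∈-image⁻ {suc δ} xs {y} y∈ with x∈p∪q⁻ (image (xs ∘ suc)) ⁅ xs zero ⁆ y∈
... | inj₁ y∈ys = let k , eq = ∈-image⁻ (xs ∘ suc) y∈ys in suc k , eq
... | inj₂ y∈x₀ = zero , sym (x∈⁅y⁆⇒x≡y (xs zero) y∈x₀)

head∉image-tail : ∀ {δ n} (xs : Fin (suc δ) → Fin n) → Injective _≡_ _≡_ xs → xs zero ∉ image (xs ∘ suc)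
head∉image-tail xs inj x₀∈ with ∈-image⁻ (xs ∘ suc) x₀∈
... | k , eq with inj eq
... | ()

∣image∣ : ∀ {δ n} (xs : Fin δ → Fin n) → Injective _≡_ _≡_ xs → ∣ image xs ∣ ≡ δ
∣image∣ {zero} {n} xs _ = ∣⊥∣≡0 n
∣image∣ {suc δ} xs inj =
  trans (∣∪⁅⁆∣ (image (xs ∘ suc)) (head∉image-tail xs inj))
        (cong suc (∣image∣ (xs ∘ suc) (Finₚ.suc-injective ∘ inj)))

∉-image : ∀ {δ n} (xs : Fin δ → Fin n) {h} → (∀ j → xs j ≢ h) → h ∉ image xs
∉-image xs xs≢h h∈ = let j , xs-j≡h = ∈-image⁻ xs h∈ in xs≢h j xs-j≡h

lookup⁅y⁆x≡true⇒x≡y : ∀ {n} (h x : Fin n) → lookup ⁅ h ⁆ x ≡ true → x ≡ h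
lookup⁅y⁆x≡true⇒x≡y h x hx = x∈⁅y⁆⇒x≡y h (lookup⇒[]= x ⁅ h ⁆ hx)

lookup⁅y⁆x≡false⇒x≢y : ∀ {n} (h x : Fin n) → lookup ⁅ h ⁆ x ≡ false → x ≢ h
lookup⁅y⁆x≡false⇒x≢y h x hx refl = contradiction (trans (sym ([]=⇒lookup (x∈⁅x⁆ h))) hx) λ ()

allIn≡image⊆ᵇ : ∀ {δ n} (xs : Fin δ → Fin n) (H : Subset n) → allIn xs H ≡ image xs ⊆ᵇ H
allIn≡image⊆ᵇ {δ} xs H rewrite map-tabulate {n = δ} (λ k → k) (lookup H ∘ xs) = go xs
  where
  go : ∀ {δ} (xs : Fin δ → Fin _) → foldr _∧_ true (tabulate (lookup H ∘ xs)) ≡ image xs ⊆ᵇ H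
  go {zero} xs = sym (⊥⊆ᵇ H)
  go {suc δ} xs = trans (cong (lookup H (xs zero) ∧_) (go (xs ∘ suc)))
                        (sym (∪⁅⁆⊆ᵇ (xs zero) (image (xs ∘ suc)) H))

-- Binomial coefficients

C*k!*[m∸k]!≡m! : ∀ {m k} → k ≤ m → (m C k) * (k ! * (m ∸ k) !) ≡ m !
C*k!*[m∸k]!≡m! {m} {k} k≤m =
  trans (cong (_* (k ! * (m ∸ k) !)) (nCk≡n!/k![n-k]! k≤m))
        (m/n*n≡m {{k !* (m ∸ k) !≢0}} (k![n∸k]!∣n! k≤m))

C≢0 : ∀ {m k} → k ≤ m → m C k ≢ 0
C≢0 {m} {k} k≤m mCk≡0 = ≢-nonZero⁻¹ (m !) {{m !≢0}}
  (trans (sym (C*k!*[m∸k]!≡m! k≤m)) (cong (_* (k ! * (m ∸ k) !)) mCk≡0))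

C[1+k]*[1+k]≡C[k]*[m∸k] : ∀ m k → (m C suc k) * suc k ≡ (m C k) * (m ∸ k)
C[1+k]*[1+k]≡C[k]*[m∸k] m k with k <? m
... | no k≮m = begin
  (m C suc k) * suc k  ≡⟨ cong (_* suc k) (k>n⇒nCk≡0 (s≤s (≮⇒≥ k≮m))) ⟩
  0                    ≡⟨ *-zeroʳ (m C k) ⟨
  (m C k) * 0          ≡⟨ cong ((m C k) *_) (m≤n⇒m∸n≡0 (≮⇒≥ k≮m)) ⟨
  (m C k) * (m ∸ k)    ∎
  where open ≡-Reasoning
... | yes k<m = *-cancelʳ-≡ _ _ (k ! * (m ∸ k) !) {{k !* (m ∸ k) !≢0}} (begin
  (m C suc k) * suc k * (k ! * (m ∸ k) !)         ≡⟨ *-assoc (m C suc k) (suc k) _ ⟩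
  (m C suc k) * (suc k * (k ! * (m ∸ k) !))       ≡⟨ cong ((m C suc k) *_) ([n-k]*d[k+1]≡[k+1]*d[k] k<m) ⟨
  (m C suc k) * ((m ∸ k) * ((suc k) ! * (m ∸ suc k) !)) ≡⟨ x∙yz≈y∙xz (m C suc k) (m ∸ k) _ ⟩
  (m ∸ k) * ((m C suc k) * ((suc k) ! * (m ∸ suc k) !)) ≡⟨ cong ((m ∸ k) *_) (C*k!*[m∸k]!≡m! k<m) ⟩
  (m ∸ k) * m !                                   ≡⟨ cong ((m ∸ k) *_) (C*k!*[m∸k]!≡m! (<⇒≤ k<m)) ⟨
  (m ∸ k) * ((m C k) * (k ! * (m ∸ k) !))         ≡⟨ x∙yz≈yx∙z (m ∸ k) (m C k) _ ⟩
  (m C k) * (m ∸ k) * (k ! * (m ∸ k) !)           ∎)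
  where
  open ≡-Reasoning
  open ℕ*ₚ using (x∙yz≈y∙xz; x∙yz≈yx∙z)

C-ratio-step : ∀ m k δ c x y → x * (k ∸ δ) ≡ (m ∸ δ) * c → x * (m C δ) ≡ (k C δ) * y →
               c * (m C suc δ) ≡ (k C suc δ) * y
C-ratio-step m k δ c x y x-recurrence x-ratio = *-cancelʳ-≡ _ _ (suc δ) (begin
  c * (m C suc δ) * suc δ    ≡⟨ *-assoc c (m C suc δ) (suc δ) ⟩
  c * ((m C suc δ) * suc δ)  ≡⟨ cong (c *_) (C[1+k]*[1+k]≡C[k]*[m∸k] m δ) ⟩
  c * ((m C δ) * (m ∸ δ))    ≡⟨ x∙yz≈y∙zx c (m C δ) (m ∸ δ) ⟩
  (m C δ) * ((m ∸ δ) * c)    ≡⟨ cong ((m C δ) *_) x-recurrence ⟨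
  (m C δ) * (x * (k ∸ δ))    ≡⟨ x∙yz≈yx∙z (m C δ) x (k ∸ δ) ⟩
  x * (m C δ) * (k ∸ δ)      ≡⟨ cong (_* (k ∸ δ)) x-ratio ⟩
  (k C δ) * y * (k ∸ δ)      ≡⟨ xy∙z≈xz∙y (k C δ) y (k ∸ δ) ⟩
  (k C δ) * (k ∸ δ) * y      ≡⟨ cong (_* y) (C[1+k]*[1+k]≡C[k]*[m∸k] k δ) ⟨
  (k C suc δ) * suc δ * y    ≡⟨ xy∙z≈xz∙y (k C suc δ) (suc δ) y ⟩
  (k C suc δ) * y * suc δ    ∎)
  where
  open ≡-Reasoning
  open ℕ*ₚ using (x∙yz≈y∙zx; x∙yz≈yx∙z; xy∙z≈xz∙y)

-- Blocks through a set

blocksThrough : ∀ {n} → (Subset n → Bool) → Subset n → ℕ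
blocksThrough {n} F T = count (λ B → F B ∧ T ⊆ᵇ B) (allSubsets n)

BlockSize : ∀ {n} → ℕ → (Subset n → Bool) → Set
BlockSize k F = ∀ B → F B ≡ true → ∣ B ∣ ≡ k

module _ {n k : ℕ} {F : Subset n → Bool} (F-size : BlockSize k F) where

  count-points-outside : ∀ S B →
    count (λ x → not (lookup S x) ∧ (F B ∧ (S ∪ ⁅ x ⁆) ⊆ᵇ B)) (allFin n)
      ≡ (if F B ∧ S ⊆ᵇ B then k ∸ ∣ S ∣ else 0)
  count-points-outside S B
    rewrite count-cong (allFin n) (λ x → cong (λ b → not (lookup S x) ∧ (F B ∧ b)) (∪⁅⁆⊆ᵇ x S B))
    with F B in FB | S ⊆ᵇ B in S⊆B
  ... | false | _ =
    trans (count-cong (allFin n) (λ x → ∧-zeroʳ (not (lookup S x)))) (count-false (allFin n))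
  ... | true | false =
    trans (count-cong (allFin n) (λ x → ∧-zeroʳ-inner (not (lookup S x)) (lookup B x)))
          (count-false (allFin n))
    where
    ∧-zeroʳ-inner : ∀ a b → a ∧ (b ∧ false) ≡ false
    ∧-zeroʳ-inner a b = trans (cong (a ∧_) (∧-zeroʳ b)) (∧-zeroʳ a)
  ... | true | true = begin
    count (λ x → not (lookup S x) ∧ (lookup B x ∧ true)) (allFin n)
      ≡⟨ count-cong (allFin n) (λ x → lookup-∁S∩B x) ⟩
    count (lookup (∁ S ∩ B)) (allFin n)  ≡⟨ count-lookup (∁ S ∩ B) ⟩
    ∣ ∁ S ∩ B ∣                         ≡⟨ m+n∸n≡m ∣ ∁ S ∩ B ∣ ∣ S ∣ ⟨
    ∣ ∁ S ∩ B ∣ + ∣ S ∣ ∸ ∣ S ∣         ≡⟨ cong (_∸ ∣ S ∣) (∣∁S∩B∣+∣S∣≡∣B∣ S B S⊆B) ⟩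
    ∣ B ∣ ∸ ∣ S ∣                       ≡⟨ cong (_∸ ∣ S ∣) (F-size B FB) ⟩
    k ∸ ∣ S ∣                           ∎
    where
    open ≡-Reasoning
    lookup-∁S∩B : ∀ x → not (lookup S x) ∧ (lookup B x ∧ true) ≡ lookup (∁ S ∩ B) x
    lookup-∁S∩B x = begin
      not (lookup S x) ∧ (lookup B x ∧ true) ≡⟨ cong (not (lookup S x) ∧_) (∧-identityʳ (lookup B x)) ⟩
      not (lookup S x) ∧ lookup B x          ≡⟨ cong (_∧ lookup B x) (lookup-map x not S) ⟨
      lookup (∁ S) x ∧ lookup B x            ≡⟨ lookup-zipWith _∧_ x (∁ S) B ⟨
      lookup (∁ S ∩ B) x                     ∎

  -- Double counting of the pairs (x , B) with x ∈ B ∖ S and S ⊆ B.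
  Σ-blocksThrough-∪⁅⁆ : ∀ S →
    sumℕ (allFin n) (λ x → if lookup S x then 0 else blocksThrough F (S ∪ ⁅ x ⁆))
      ≡ blocksThrough F S * (k ∸ ∣ S ∣)
  Σ-blocksThrough-∪⁅⁆ S = begin
    sumℕ X (λ x → if lookup S x then 0 else blocksThrough F (S ∪ ⁅ x ⁆))
      ≡⟨ sumℕ-cong X outside-as-sum ⟩
    sumℕ X (λ x → sumℕ L (λ B → toℕ (incident x B)))
      ≡⟨ sumℕ-swap X L (λ x B → toℕ (incident x B)) ⟩
    sumℕ L (λ B → sumℕ X (λ x → toℕ (incident x B)))
      ≡⟨ sumℕ-cong L (λ B → trans (sym (count≡sumℕ (λ x → incident x B) X)) (count-points-outside S B)) ⟩
    sumℕ L (λ B → if F B ∧ S ⊆ᵇ B then k ∸ ∣ S ∣ else 0)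
      ≡⟨ sumℕ-indicator (λ B → F B ∧ S ⊆ᵇ B) (k ∸ ∣ S ∣) L ⟩
    blocksThrough F S * (k ∸ ∣ S ∣) ∎
    where
    open ≡-Reasoning
    X = allFin n
    L = allSubsets n
    incident : Fin n → Subset n → Bool
    incident x B = not (lookup S x) ∧ (F B ∧ (S ∪ ⁅ x ⁆) ⊆ᵇ B)
    outside-as-sum : ∀ x →
      (if lookup S x then 0 else blocksThrough F (S ∪ ⁅ x ⁆)) ≡ sumℕ L (λ B → toℕ (incident x B))
    outside-as-sum x with lookup S x
    ... | true  = sym (sumℕ-zero L)
    ... | false = count≡sumℕ _ L

  blocksThrough-recurrence : ∀ S D c →
    (∀ x → x ∉ S → blocksThrough F (S ∪ ⁅ x ⁆) ≡ (if lookup D x then 0 else c)) →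
    blocksThrough F S * (k ∸ ∣ S ∣) ≡ (n ∸ ∣ S ∪ D ∣) * c
  blocksThrough-recurrence S D c through-S∪x = begin
    blocksThrough F S * (k ∸ ∣ S ∣)
      ≡⟨ Σ-blocksThrough-∪⁅⁆ S ⟨
    sumℕ (allFin n) (λ x → if lookup S x then 0 else blocksThrough F (S ∪ ⁅ x ⁆))
      ≡⟨ sumℕ-cong (allFin n) term ⟩
    sumℕ (allFin n) (λ x → if not (lookup (S ∪ D) x) then c else 0)
      ≡⟨ sumℕ-indicator (λ x → not (lookup (S ∪ D) x)) c (allFin n) ⟩
    count (λ x → not (lookup (S ∪ D) x)) (allFin n) * c
      ≡⟨ cong (_* c) (count-∉ (S ∪ D)) ⟩
    (n ∸ ∣ S ∪ D ∣) * c ∎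
    where
    open ≡-Reasoning
    term : ∀ x → (if lookup S x then 0 else blocksThrough F (S ∪ ⁅ x ⁆))
                   ≡ (if not (lookup (S ∪ D) x) then c else 0)
    term x rewrite lookup-zipWith _∨_ x S D with lookup S x in Sx
    ... | true  = refl
    ... | false with lookup D x
                   | through-S∪x x (λ x∈S → contradiction (trans (sym ([]=⇒lookup x∈S)) Sx) λ ())
    ...   | true  | eq = eq
    ...   | false | eq = eq

Regular : ∀ {n} → (Subset n → Bool) → ℕ → Set
Regular F s = ∃ λ c → ∀ T → ∣ T ∣ ≡ s → blocksThrough F T ≡ c

regular-pred : ∀ {n k s} {F : Subset n → Bool} → BlockSize k F → s < k →
               Regular F (suc s) → Regular F s
regular-pred {n} {k} {s} {F} F-size s<k (c , through-T) = (n ∸ s) * c / (k ∸ s) , through-S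
  where
  instance
    k∸s≢0 : NonZero (k ∸ s)
    k∸s≢0 = >-nonZero (m<n⇒0<n∸m s<k)
  through-S : ∀ S → ∣ S ∣ ≡ s → blocksThrough F S ≡ (n ∸ s) * c / (k ∸ s)
  through-S S refl = begin
    blocksThrough F S                       ≡⟨ m*n/n≡m (blocksThrough F S) (k ∸ s) ⟨
    blocksThrough F S * (k ∸ s) / (k ∸ s)   ≡⟨ cong (_/ (k ∸ s)) recurrence ⟩
    (n ∸ s) * c / (k ∸ s)                   ∎
    where
    open ≡-Reasoning
    recurrence : blocksThrough F S * (k ∸ s) ≡ (n ∸ s) * c
    recurrence = trans
      (blocksThrough-recurrence F-size S ⊥ c λ x x∉S →
         trans (through-T (S ∪ ⁅ x ⁆) (∣∪⁅⁆∣ S x∉S))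
               (cong (if_then 0 else c) (sym (lookup-replicate x false))))
      (cong (λ S′ → (n ∸ ∣ S′ ∣) * c) (∪-identityʳ S))

design-regular : ∀ {t n k lam} {F : Subset n → Bool} → IsDesign t n k lam F →
                 ∀ {s} → s ≤ t → Regular F s
design-regular {t} {n} {k} {lam} {F} design s≤t = regular (≤⇒≤‴ s≤t)
  where
  open IsDesign design
  regular : ∀ {s} → s ≤‴ t → Regular F s
  regular ≤‴-refl = lam , balanced
  regular (≤‴-step s<t) = regular-pred blockSize (<-≤-trans (≤‴⇒≤ s<t) t≤k) (regular s<t)

avoiding : ∀ {n} → Fin n → (Subset n → Bool) → Subset n → Bool
avoiding h F B = F B ∧ not (lookup B h)

avoiding-size : ∀ {n k} {F : Subset n → Bool} (h : Fin n) → BlockSize k F → BlockSize k (avoiding h F)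
avoiding-size {F = F} h F-size B avoids with F B in FB
... | true = F-size B FB

blocksThrough-split : ∀ {n} (F : Subset n → Bool) (h : Fin n) (T : Subset n) →
  blocksThrough F T ≡ blocksThrough (avoiding h F) T + blocksThrough F (T ∪ ⁅ h ⁆)
blocksThrough-split {n} F h T = begin
  blocksThrough F T
    ≡⟨ count-split (λ B → F B ∧ T ⊆ᵇ B) (λ B → lookup B h) L ⟩
  count (λ B → (F B ∧ T ⊆ᵇ B) ∧ lookup B h) L + count (λ B → (F B ∧ T ⊆ᵇ B) ∧ not (lookup B h)) L
    ≡⟨ +-comm (count (λ B → (F B ∧ T ⊆ᵇ B) ∧ lookup B h) L) _ ⟩
  count (λ B → (F B ∧ T ⊆ᵇ B) ∧ not (lookup B h)) L + count (λ B → (F B ∧ T ⊆ᵇ B) ∧ lookup B h) L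
    ≡⟨ cong₂ _+_ (count-cong L (λ B → ∧-swapʳ (F B) _ _)) (count-cong L through-h) ⟩
  blocksThrough (avoiding h F) T + blocksThrough F (T ∪ ⁅ h ⁆) ∎
  where
  open ≡-Reasoning
  L = allSubsets n
  ∧-swapʳ : ∀ a b c → (a ∧ b) ∧ c ≡ (a ∧ c) ∧ b
  ∧-swapʳ true  b c = ∧-comm b c
  ∧-swapʳ false b c = refl
  through-h : ∀ B → (F B ∧ T ⊆ᵇ B) ∧ lookup B h ≡ F B ∧ (T ∪ ⁅ h ⁆) ⊆ᵇ B
  through-h B rewrite ∪⁅⁆⊆ᵇ h T B with F B
  ... | true  = ∧-comm (T ⊆ᵇ B) (lookup B h)
  ... | false = refl

blocksThrough-avoiding-∪⁅⁆ : ∀ {n} (F : Subset n → Bool) (h : Fin n) (S : Subset n) →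
                             blocksThrough (avoiding h F) (S ∪ ⁅ h ⁆) ≡ 0
blocksThrough-avoiding-∪⁅⁆ {n} F h S =
  trans (count-cong (allSubsets n) misses-h) (count-false (allSubsets n))
  where
  misses-h : ∀ B → avoiding h F B ∧ (S ∪ ⁅ h ⁆) ⊆ᵇ B ≡ false
  misses-h B rewrite ∪⁅⁆⊆ᵇ h S B with F B | lookup B h
  ... | true  | true  = refl
  ... | true  | false = refl
  ... | false | _     = refl

RegularAvoiding : ∀ {n} → Fin n → (Subset n → Bool) → ℕ → Set
RegularAvoiding h F s = ∃ λ c → ∀ T → ∣ T ∣ ≡ s → h ∉ T → blocksThrough (avoiding h F) T ≡ c

regular-avoiding : ∀ {n s} {F : Subset n → Bool} (h : Fin n) →
                   Regular F s → Regular F (suc s) → RegularAvoiding h F s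
regular-avoiding {F = F} h (c , through) (c′ , through′) = c ∸ c′ , λ T ∣T∣≡s h∉T → begin
  blocksThrough (avoiding h F) T
    ≡⟨ m+n∸n≡m _ (blocksThrough F (T ∪ ⁅ h ⁆)) ⟨
  blocksThrough (avoiding h F) T + blocksThrough F (T ∪ ⁅ h ⁆) ∸ blocksThrough F (T ∪ ⁅ h ⁆)
    ≡⟨ cong₂ _∸_ (sym (blocksThrough-split F h T))
                 (through′ (T ∪ ⁅ h ⁆) (trans (∣∪⁅⁆∣ T h∉T) (cong suc ∣T∣≡s))) ⟩
  blocksThrough F T ∸ c′
    ≡⟨ cong (_∸ c′) (through T ∣T∣≡s) ⟩
  c ∸ c′ ∎
  where open ≡-Reasoning

module _ {n k : ℕ} {F : Subset n → Bool} (h : Fin n) (F-size : BlockSize k F) where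

  private
    G = avoiding h F

  blocksThrough-avoiding-recurrence : ∀ {s c} → (∀ T → ∣ T ∣ ≡ suc s → h ∉ T → blocksThrough G T ≡ c) →
    ∀ S → ∣ S ∣ ≡ s → h ∉ S → blocksThrough G S * (k ∸ s) ≡ (n ∸ 1 ∸ s) * c
  blocksThrough-avoiding-recurrence {c = c} through S refl h∉S = begin
    blocksThrough G S * (k ∸ ∣ S ∣)
      ≡⟨ blocksThrough-recurrence (avoiding-size h F-size) S ⁅ h ⁆ c through-S∪x ⟩
    (n ∸ ∣ S ∪ ⁅ h ⁆ ∣) * c  ≡⟨ cong (λ m → (n ∸ m) * c) (∣∪⁅⁆∣ S h∉S) ⟩
    (n ∸ suc ∣ S ∣) * c      ≡⟨ cong (_* c) (∸-+-assoc n 1 ∣ S ∣) ⟨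
    (n ∸ 1 ∸ ∣ S ∣) * c      ∎
    where
    open ≡-Reasoning
    through-S∪x : ∀ x → x ∉ S → blocksThrough G (S ∪ ⁅ x ⁆) ≡ (if lookup ⁅ h ⁆ x then 0 else c)
    through-S∪x x x∉S with lookup ⁅ h ⁆ x in hx
    ... | true  = trans (cong (λ y → blocksThrough G (S ∪ ⁅ y ⁆)) (lookup⁅y⁆x≡true⇒x≡y h x hx))
                        (blocksThrough-avoiding-∪⁅⁆ F h S)
    ... | false = through (S ∪ ⁅ x ⁆) (∣∪⁅⁆∣ S x∉S) h∉S∪x
      where
      h∉S∪x : h ∉ S ∪ ⁅ x ⁆
      h∉S∪x h∈ with x∈p∪q⁻ S ⁅ x ⁆ h∈
      ... | inj₁ h∈S = h∉S h∈S
      ... | inj₂ h∈x = lookup⁅y⁆x≡false⇒x≢y h x hx (sym (x∈⁅y⁆⇒x≡y x h∈x))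

  blocksThrough-avoiding-image : ∀ {δ} → (∀ {s} → s ≤ δ → RegularAvoiding h F s) →
    (xs : Fin δ → Fin n) → Injective _≡_ _≡_ xs → (∀ j → xs j ≢ h) →
    blocksThrough G (image xs) * ((n ∸ 1) C δ) ≡ (k C δ) * blocksThrough G ⊥
  blocksThrough-avoiding-image {zero} _ _ _ _ = *-comm (blocksThrough G ⊥) 1
  blocksThrough-avoiding-image {suc δ} regular xs inj xs≢h =
    subst (λ b → b * ((n ∸ 1) C suc δ) ≡ (k C suc δ) * blocksThrough G ⊥)
          (sym (through (image xs) (∣image∣ xs inj) (∉-image xs xs≢h)))
          (C-ratio-step (n ∸ 1) k δ c (blocksThrough G S) (blocksThrough G ⊥)
             (blocksThrough-avoiding-recurrence through S (∣image∣ ys ys-inj) (∉-image ys (xs≢h ∘ suc)))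
             (blocksThrough-avoiding-image (regular ∘ m≤n⇒m≤1+n) ys ys-inj (xs≢h ∘ suc)))
    where
    ys = xs ∘ suc
    S = image ys
    ys-inj : Injective _≡_ _≡_ ys
    ys-inj = Finₚ.suc-injective ∘ inj
    c = proj₁ (regular ≤-refl)
    through = proj₂ (regular ≤-refl)

-- Exposing the normal form of ℕ→ℚ k lets ℚ's _+_ and _*_ compute on embedded naturals.
ℕ→ℚ≡mkℚ : ∀ k → ℕ→ℚ k ≡ mkℚ (ℤ.+ k) 0 (Coprime-sym (1-coprimeTo k))
ℕ→ℚ≡mkℚ k = ↥p/↧p≡p (mkℚ (ℤ.+ k) 0 (Coprime-sym (1-coprimeTo k)))

ℕ→ℚ-* : ∀ x y → ℕ→ℚ (x * y) ≡ ℕ→ℚ x ℚ.* ℕ→ℚ y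
ℕ→ℚ-* x y = trans (cong (ℚ._/ 1) (ℤₚ.pos-* x y)) (sym (cong₂ ℚ._*_ (ℕ→ℚ≡mkℚ x) (ℕ→ℚ≡mkℚ y)))

ℕ→ℚ-suc : ∀ x → ℕ→ℚ (suc x) ≡ 1ℚ ℚ.+ ℕ→ℚ x
ℕ→ℚ-suc x = trans (cong (λ z → (ℤ.+ 1 ℤ.+ z) ℚ./ 1) (sym (ℤₚ.*-identityʳ (ℤ.+ x))))
                  (sym (cong (1ℚ ℚ.+_) (ℕ→ℚ≡mkℚ x)))

ℕ→ℚ-≢0 : ∀ {k} → k ≢ 0 → ℕ→ℚ k ≢ 0ℚ
ℕ→ℚ-≢0 {zero} k≢0 = contradiction refl k≢0
ℕ→ℚ-≢0 {suc k} _ k≡0 with trans (sym (ℕ→ℚ≡mkℚ (suc k))) k≡0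
... | ()

Σℚ-cong : ∀ {A : Set} {f g : A → ℚ} (xs : List A) → (∀ x → f x ≡ g x) → Σℚ xs f ≡ Σℚ xs g
Σℚ-cong [] _ = refl
Σℚ-cong (x ∷ xs) f≗g = cong₂ ℚ._+_ (f≗g x) (Σℚ-cong xs f≗g)

Σℚ-indicator : ∀ {A : Set} (p : A → Bool) (r : ℚ) (xs : List A) →
               Σℚ xs (λ x → if p x then r else 0ℚ) ≡ ℕ→ℚ (count p xs) ℚ.* r
Σℚ-indicator p r [] = sym (ℚₚ.*-zeroˡ r)
Σℚ-indicator p r (x ∷ xs) rewrite count-∷ p x xs with p x
... | true  = begin
  r ℚ.+ Σℚ xs (λ x → if p x then r else 0ℚ)  ≡⟨ cong (r ℚ.+_) (Σℚ-indicator p r xs) ⟩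
  r ℚ.+ ℕ→ℚ (count p xs) ℚ.* r               ≡⟨ cong (ℚ._+ (ℕ→ℚ (count p xs) ℚ.* r)) (ℚₚ.*-identityˡ r) ⟨
  1ℚ ℚ.* r ℚ.+ ℕ→ℚ (count p xs) ℚ.* r        ≡⟨ ℚₚ.*-distribʳ-+ r 1ℚ (ℕ→ℚ (count p xs)) ⟨
  (1ℚ ℚ.+ ℕ→ℚ (count p xs)) ℚ.* r            ≡⟨ cong (ℚ._* r) (ℕ→ℚ-suc (count p xs)) ⟨
  ℕ→ℚ (suc (count p xs)) ℚ.* r               ∎
  where open ≡-Reasoning
... | false = trans (ℚₚ.+-identityˡ _) (Σℚ-indicator p r xs)

÷?≡*1/ : ∀ u v (v≢0 : v ≢ 0ℚ) → u ÷? v ≡ u ℚ.* (1/ v) {{ℚ.≢-nonZero v≢0}}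
÷?≡*1/ u v v≢0 with v ≟ℚ 0ℚ
... | yes v≡0 = contradiction v≡0 v≢0
... | no _    = refl

÷?-cross : ∀ u v u′ v′ → v ≢ 0ℚ → v′ ≢ 0ℚ → u ℚ.* v′ ≡ u′ ℚ.* v → u ÷? v ≡ u′ ÷? v′
÷?-cross u v u′ v′ v≢0 v′≢0 cross = begin
  u ÷? v                             ≡⟨ ÷?≡*1/ u v v≢0 ⟩
  u ℚ.* v⁻¹                          ≡⟨ ℚₚ.*-identityʳ _ ⟨
  u ℚ.* v⁻¹ ℚ.* 1ℚ                   ≡⟨ cong (u ℚ.* v⁻¹ ℚ.*_) (ℚₚ.*-inverseʳ v′ {{v′≢0′}}) ⟨
  u ℚ.* v⁻¹ ℚ.* (v′ ℚ.* v′⁻¹)        ≡⟨ interchange u v⁻¹ v′ v′⁻¹ ⟩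
  u ℚ.* v′ ℚ.* (v⁻¹ ℚ.* v′⁻¹)        ≡⟨ cong₂ ℚ._*_ cross (ℚₚ.*-comm v⁻¹ v′⁻¹) ⟩
  u′ ℚ.* v ℚ.* (v′⁻¹ ℚ.* v⁻¹)        ≡⟨ interchange u′ v v′⁻¹ v⁻¹ ⟩
  u′ ℚ.* v′⁻¹ ℚ.* (v ℚ.* v⁻¹)        ≡⟨ cong (u′ ℚ.* v′⁻¹ ℚ.*_) (ℚₚ.*-inverseʳ v {{v≢0′}}) ⟩
  u′ ℚ.* v′⁻¹ ℚ.* 1ℚ                 ≡⟨ ℚₚ.*-identityʳ _ ⟩
  u′ ℚ.* v′⁻¹                        ≡⟨ ÷?≡*1/ u′ v′ v′≢0 ⟨
  u′ ÷? v′                           ∎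
  where
  open ≡-Reasoning
  open ℚ*ₚ using (interchange)
  v≢0′ = ℚ.≢-nonZero v≢0
  v′≢0′ = ℚ.≢-nonZero v′≢0
  v⁻¹ = (1/ v) {{v≢0′}}
  v′⁻¹ = (1/ v′) {{v′≢0′}}

*≡1ℚ⇒≢0 : ∀ u v → u ℚ.* v ≡ 1ℚ → u ≢ 0ℚ
*≡1ℚ⇒≢0 u v uv≡1 u≡0 with trans (sym uv≡1) (trans (cong (ℚ._* v) u≡0) (ℚₚ.*-zeroˡ v))
... | ()

*-≢0 : ∀ u v → u ≢ 0ℚ → v ≢ 0ℚ → u ℚ.* v ≢ 0ℚ
*-≢0 u v u≢0 v≢0 uv≡0 = v≢0 (begin
  v                     ≡⟨ ℚₚ.*-identityˡ v ⟨
  1ℚ ℚ.* v              ≡⟨ cong (ℚ._* v) (ℚₚ.*-inverseˡ u {{u≢0′}}) ⟨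
  u⁻¹ ℚ.* u ℚ.* v       ≡⟨ ℚₚ.*-assoc u⁻¹ u v ⟩
  u⁻¹ ℚ.* (u ℚ.* v)     ≡⟨ cong (u⁻¹ ℚ.*_) uv≡0 ⟩
  u⁻¹ ℚ.* 0ℚ            ≡⟨ ℚₚ.*-zeroʳ u⁻¹ ⟩
  0ℚ                    ∎)
  where
  open ≡-Reasoning
  u≢0′ = ℚ.≢-nonZero u≢0
  u⁻¹ = (1/ u) {{u≢0′}}

*-inverse-unique : ∀ g x y → g ℚ.* x ≡ 1ℚ → g ℚ.* y ≡ 1ℚ → x ≡ y
*-inverse-unique g x y gx≡1 gy≡1 = begin
  x                  ≡⟨ ℚₚ.*-identityʳ x ⟨
  x ℚ.* 1ℚ           ≡⟨ cong (x ℚ.*_) gy≡1 ⟨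
  x ℚ.* (g ℚ.* y)    ≡⟨ x∙yz≈yx∙z x g y ⟩
  g ℚ.* x ℚ.* y      ≡⟨ cong (ℚ._* y) gx≡1 ⟩
  1ℚ ℚ.* y           ≡⟨ ℚₚ.*-identityˡ y ⟩
  y                  ∎
  where
  open ≡-Reasoning
  open ℚ*ₚ using (x∙yz≈yx∙z)

1÷?v*v≡1 : ∀ v → v ≢ 0ℚ → (1ℚ ÷? v) ℚ.* v ≡ 1ℚ
1÷?v*v≡1 v v≢0 = trans (cong (ℚ._* v) (trans (÷?≡*1/ 1ℚ v v≢0) (ℚₚ.*-identityˡ v⁻¹)))
                       (ℚₚ.*-inverseˡ v {{v≢0′}})
  where
  v≢0′ = ℚ.≢-nonZero v≢0
  v⁻¹ = (1/ v) {{v≢0′}}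

∈-allSubsets : ∀ {n} (S : Subset n) → S ∈ˡ allSubsets n
∈-allSubsets [] = Any.here refl
∈-allSubsets (b ∷ S) =
  ∈-concatMap⁺ (λ s → (true ∷ s) ∷ (false ∷ s) ∷ []) (Any.map (λ { refl → ∷-∈ b }) (∈-allSubsets S))
  where
  ∷-∈ : ∀ b → (b ∷ S) ∈ˡ ((true ∷ S) ∷ (false ∷ S) ∷ [])
  ∷-∈ true  = Any.here refl
  ∷-∈ false = Any.there (Any.here refl)

sumℕ-≢0 : ∀ {A : Set} (f : A → ℕ) {xs : List A} {x} → x ∈ˡ xs → f x ≢ 0 → sumℕ xs f ≢ 0
sumℕ-≢0 f {y ∷ _} (Any.here refl) fx≢0 sum≡0 = fx≢0 (m+n≡0⇒m≡0 (f y) sum≡0)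
sumℕ-≢0 f {y ∷ _} (Any.there x∈) fx≢0 sum≡0 = sumℕ-≢0 f x∈ fx≢0 (m+n≡0⇒n≡0 (f y) sum≡0)

count-≢0 : ∀ {A : Set} (p : A → Bool) {xs : List A} {x} → x ∈ˡ xs → p x ≡ true → count p xs ≢ 0
count-≢0 p {xs} x∈ px count≡0 =
  sumℕ-≢0 (toℕ ∘ p) x∈ (λ px≡0 → case trans (sym (cong toℕ px)) px≡0 of λ ())
          (trans (sym (count≡sumℕ p xs)) count≡0)

÷?-scaled : ∀ X Y P Q r → Y ≢ 0 → Q ≢ 0 → r ≢ 0ℚ → X * Q ≡ P * Y →
            (ℕ→ℚ X ℚ.* r) ÷? (ℕ→ℚ Y ℚ.* r) ≡ ℕ→ℚ P ÷? ℕ→ℚ Q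
÷?-scaled X Y P Q r Y≢0 Q≢0 r≢0 XQ≡PY =
  ÷?-cross _ _ _ _ (*-≢0 (ℕ→ℚ Y) r (ℕ→ℚ-≢0 Y≢0) r≢0) (ℕ→ℚ-≢0 Q≢0) (begin
    ℕ→ℚ X ℚ.* r ℚ.* ℕ→ℚ Q    ≡⟨ xy∙z≈xz∙y (ℕ→ℚ X) r (ℕ→ℚ Q) ⟩
    ℕ→ℚ X ℚ.* ℕ→ℚ Q ℚ.* r    ≡⟨ cong (ℚ._* r) (ℕ→ℚ-* X Q) ⟨
    ℕ→ℚ (X * Q) ℚ.* r        ≡⟨ cong (λ z → ℕ→ℚ z ℚ.* r) XQ≡PY ⟩
    ℕ→ℚ (P * Y) ℚ.* r        ≡⟨ cong (ℚ._* r) (ℕ→ℚ-* P Y) ⟩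
    ℕ→ℚ P ℚ.* ℕ→ℚ Y ℚ.* r    ≡⟨ ℚₚ.*-assoc (ℕ→ℚ P) (ℕ→ℚ Y) r ⟩
    ℕ→ℚ P ℚ.* (ℕ→ℚ Y ℚ.* r)  ∎)
  where
  open ≡-Reasoning
  open ℚ*ₚ using (xy∙z≈xz∙y)

-- Probabilities

γ*p≡1 : ∀ {n a m} (σ : Strategy n a m) (equitable : Equitable σ) →
        ∀ H i → 𝒜 σ i H ≡ true → ℕ→ℚ (proj₁ equitable) ℚ.* p σ H i ≡ 1ℚ
γ*p≡1 {m = m} σ (γ , γ-size , uniform) H i H∈𝒜ᵢ = begin
  ℕ→ℚ γ ℚ.* p σ H i                                  ≡⟨ cong (λ g → ℕ→ℚ g ℚ.* p σ H i) (γ-size H ∣H∣≡a) ⟨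
  ℕ→ℚ (gSize σ H) ℚ.* p σ H i                        ≡⟨ Σℚ-indicator (λ j → 𝒜 σ j H) (p σ H i) (allFin m) ⟨
  Σℚ (allFin m) (λ j → if 𝒜 σ j H then p σ H i else 0ℚ) ≡⟨ Σℚ-cong (allFin m) p-on-g ⟩
  Σℚ (allFin m) (p σ H)                              ≡⟨ p-sum σ H ∣H∣≡a ⟩
  1ℚ                                                 ∎
  where
  open ≡-Reasoning
  ∣H∣≡a = 𝒜-size σ i H H∈𝒜ᵢ
  p-on-g : ∀ j → (if 𝒜 σ j H then p σ H i else 0ℚ) ≡ p σ H j
  p-on-g j with 𝒜 σ j H in H∈𝒜ⱼ
  ... | true  = uniform H i j ∣H∣≡a H∈𝒜ᵢ H∈𝒜ⱼ
  ... | false = sym (p-zero σ H j ∣H∣≡a H∈𝒜ⱼ)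

==⇒≡ : ∀ {m k} → (m == k) ≡ true → m ≡ k
==⇒≡ {m} {k} m==k = ≡ᵇ⇒≡ m k (subst T (sym m==k) _)

validDeal-⁅⁆ : ∀ {n} a (H : Subset n) (h : Fin n) →
               validDeal a 1 H ⁅ h ⁆ ≡ (∣ H ∣ == a) ∧ not (lookup H h)
validDeal-⁅⁆ a H h rewrite ∣⁅x⁆∣≡1 h | disjointᵇ-⁅⁆ H h = refl

module Announcement {n a m} (σ : Strategy n a m) (equitable : Equitable σ)
                    (i : Fin m) (h : Fin n) {H₀ : Subset n} (H₀∈𝒜ᵢ : 𝒜 σ i H₀ ≡ true) where

  private
    G = avoiding h (𝒜 σ i)
    N = numDeals n a 1
    γ = proj₁ equitable

  -- The probability that a given hand of 𝒜ᵢ avoiding h is dealt, with Cathy holding h, and then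
  -- announces i; by equitability it is the same for every such hand.
  r : ℚ
  r = (1ℚ ÷? ℕ→ℚ N) ℚ.* p σ H₀ i

  dealProb-⁅⁆ : ∀ H →
    dealProb a 1 H ⁅ h ⁆ ≡ (if (∣ H ∣ == a) ∧ not (lookup H h) then 1ℚ ÷? ℕ→ℚ N else 0ℚ)
  dealProb-⁅⁆ H = cong (if_then 1ℚ ÷? ℕ→ℚ N else 0ℚ) (validDeal-⁅⁆ a H h)

  -- Stated for an arbitrary d: abstracting 1ℚ ÷? ℕ→ℚ N keeps the case analysis from normalising it.
  hand-announced : ∀ (d : ℚ) H →
    (if (∣ H ∣ == a) ∧ not (lookup H h) then d else 0ℚ) ℚ.* p σ H i
      ≡ (if G H then d ℚ.* p σ H₀ i else 0ℚ)
  hand-announced d H with 𝒜 σ i H in H∈𝒜ᵢ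
  ... | true with (∣ H ∣ == a) | dec-true (∣ H ∣ ≟ a) (𝒜-size σ i H H∈𝒜ᵢ) | lookup H h
  ...   | _ | refl | true  = ℚₚ.*-zeroˡ (p σ H i)
  ...   | _ | refl | false = cong (d ℚ.*_)
          (*-inverse-unique (ℕ→ℚ γ) _ _ (γ*p≡1 σ equitable H i H∈𝒜ᵢ) (γ*p≡1 σ equitable H₀ i H₀∈𝒜ᵢ))
  hand-announced d H | false with ∣ H ∣ == a in sized | lookup H h
  ... | true  | false = trans (cong (d ℚ.*_) (p-zero σ H i (==⇒≡ sized) H∈𝒜ᵢ)) (ℚₚ.*-zeroʳ d)
  ... | true  | true  = ℚₚ.*-zeroˡ (p σ H i)
  ... | false | _     = ℚₚ.*-zeroˡ (p σ H i)

  dealt-and-announced : ∀ H → dealProb a 1 H ⁅ h ⁆ ℚ.* p σ H i ≡ (if G H then r else 0ℚ)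
  dealt-and-announced H = trans (cong (ℚ._* p σ H i) (dealProb-⁅⁆ H)) (hand-announced (1ℚ ÷? ℕ→ℚ N) H)

  PrJoint-⊆ᵇ : ∀ (E : Subset n → Bool) T → (∀ H → E H ≡ T ⊆ᵇ H) →
               PrJoint σ 1 E i ⁅ h ⁆ ≡ ℕ→ℚ (blocksThrough G T) ℚ.* r
  PrJoint-⊆ᵇ E T E≗T⊆ᵇ =
    trans (Σℚ-cong (allSubsets n) term) (Σℚ-indicator (λ H → G H ∧ T ⊆ᵇ H) r (allSubsets n))
    where
    if-∧ : ∀ e g (x : ℚ) → x ≡ (if g then r else 0ℚ) → (if e then x else 0ℚ) ≡ (if g ∧ e then r else 0ℚ)
    if-∧ true  true  x x≡r = x≡r
    if-∧ true  false x x≡0 = x≡0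
    if-∧ false true  x _   = refl
    if-∧ false false x _   = refl
    term : ∀ H → (if E H then dealProb a 1 H ⁅ h ⁆ ℚ.* p σ H i else 0ℚ)
                   ≡ (if G H ∧ T ⊆ᵇ H then r else 0ℚ)
    term H = trans (cong (if_then dealProb a 1 H ⁅ h ⁆ ℚ.* p σ H i else 0ℚ) (E≗T⊆ᵇ H))
                   (if-∧ (T ⊆ᵇ H) (G H) _ (dealt-and-announced H))

  r≢0 : disjointᵇ H₀ ⁅ h ⁆ ≡ true → r ≢ 0ℚ
  r≢0 H₀∩h≡∅ = *≡1ℚ⇒≢0 r (ℕ→ℚ N ℚ.* ℕ→ℚ γ) (begin
    (1ℚ ÷? ℕ→ℚ N) ℚ.* q ℚ.* (ℕ→ℚ N ℚ.* ℕ→ℚ γ)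
      ≡⟨ interchange (1ℚ ÷? ℕ→ℚ N) q (ℕ→ℚ N) (ℕ→ℚ γ) ⟩
    (1ℚ ÷? ℕ→ℚ N) ℚ.* ℕ→ℚ N ℚ.* (q ℚ.* ℕ→ℚ γ)
      ≡⟨ cong₂ ℚ._*_ (1÷?v*v≡1 (ℕ→ℚ N) (ℕ→ℚ-≢0 N≢0)) (ℚₚ.*-comm q (ℕ→ℚ γ)) ⟩
    1ℚ ℚ.* (ℕ→ℚ γ ℚ.* q)                        ≡⟨ ℚₚ.*-identityˡ _ ⟩
    ℕ→ℚ γ ℚ.* q                                 ≡⟨ γ*p≡1 σ equitable H₀ i H₀∈𝒜ᵢ ⟩
    1ℚ                                          ∎)
    where
    open ≡-Reasoning
    open ℚ*ₚ using (interchange)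
    q = p σ H₀ i
    H₀-dealt : validDeal a 1 H₀ ⁅ h ⁆ ≡ true
    H₀-dealt = trans (validDeal-⁅⁆ a H₀ h)
      (cong₂ _∧_ (dec-true (∣ H₀ ∣ ≟ a) (𝒜-size σ i H₀ H₀∈𝒜ᵢ)) (trans (sym (disjointᵇ-⁅⁆ H₀ h)) H₀∩h≡∅))
    N≢0 : N ≢ 0
    N≢0 = sumℕ-≢0 _ (∈-allSubsets H₀) (count-≢0 _ (∈-allSubsets ⁅ h ⁆) H₀-dealt)

PrCond-⁅⁆ : ∀ {n a b t lam m} (σ : Strategy n a m) → Equitable σ →
            (∀ i → IsDesign t n a lam (𝒜 σ i)) → a + b + 1 ≡ n →
            ∀ {δ′} → δ′ < t → ∀ i h {H₀} → 𝒜 σ i H₀ ≡ true → disjointᵇ H₀ ⁅ h ⁆ ≡ true →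
            (xs : Fin δ′ → Fin n) → Injective _≡_ _≡_ xs → (∀ j → xs j ≢ h) →
            PrCond σ 1 (allIn xs) i ⁅ h ⁆ ≡ ℕ→ℚ (a C δ′) ÷? ℕ→ℚ ((a + b) C δ′)
PrCond-⁅⁆ {a = a} {b} σ equitable design refl {δ′} δ′<t i h {H₀} H₀∈𝒜ᵢ H₀∩h≡∅ xs xs-inj xs≢h = begin
  PrCond σ 1 (allIn xs) i ⁅ h ⁆
    ≡⟨ cong₂ _÷?_ (PrJoint-⊆ᵇ (allIn xs) (image xs) (allIn≡image⊆ᵇ xs))
                  (PrJoint-⊆ᵇ (λ _ → true) ⊥ (sym ∘ ⊥⊆ᵇ)) ⟩
  (ℕ→ℚ (blocksThrough G (image xs)) ℚ.* r) ÷? (ℕ→ℚ (blocksThrough G ⊥) ℚ.* r)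
    ≡⟨ ÷?-scaled (blocksThrough G (image xs)) (blocksThrough G ⊥) (a C δ′) ((a + b) C δ′) r
                 H₀-through-⊥ (C≢0 δ′≤a+b) (r≢0 H₀∩h≡∅) ratio ⟩
  ℕ→ℚ (a C δ′) ÷? ℕ→ℚ ((a + b) C δ′) ∎
  where
  open ≡-Reasoning
  open Announcement σ equitable i h H₀∈𝒜ᵢ
  open IsDesign (design i) using (t≤k; blockSize)
  G = avoiding h (𝒜 σ i)
  δ′≤a+b : δ′ ≤ a + b
  δ′≤a+b = ≤-trans (<⇒≤ δ′<t) (≤-trans t≤k (m≤m+n a b))
  regular : ∀ {s} → s ≤ δ′ → RegularAvoiding h (𝒜 σ i) s
  regular s≤δ′ =
    regular-avoiding h (design-regular (design i) (<⇒≤ s<t)) (design-regular (design i) s<t)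
    where s<t = ≤-<-trans s≤δ′ δ′<t
  ratio : blocksThrough G (image xs) * ((a + b) C δ′) ≡ (a C δ′) * blocksThrough G ⊥
  ratio = subst (λ v → blocksThrough G (image xs) * (v C δ′) ≡ (a C δ′) * blocksThrough G ⊥)
                (m+n∸n≡m (a + b) 1)
                (blocksThrough-avoiding-image h blockSize regular xs xs-inj xs≢h)
  H₀-through-⊥ : blocksThrough G ⊥ ≢ 0
  H₀-through-⊥ = count-≢0 _ (∈-allSubsets H₀)
    (cong₂ _∧_ (cong₂ _∧_ H₀∈𝒜ᵢ (trans (sym (disjointᵇ-⁅⁆ H₀ h)) H₀∩h≡∅)) (⊥⊆ᵇ H₀))

lemma9 : (n a b t lam m : ℕ) → 1 ≤ a → 1 ≤ b → a + b + 1 ≡ n → 2 ≤ t →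
         (σ : Strategy n a m) → Equitable σ →
         (∀ i → IsDesign t n a lam (𝒜 σ i)) →
         PerfectlySecure σ b 1 (t ∸ 1)
lemma9 n a b (suc t) lam m _ _ a+b+1≡n (s≤s _) σ equitable design δ′ _ δ′≤t i HC ∣HC∣≡1
       (H₀ , H₀∈𝒜ᵢ , H₀∩HC≡∅) xs xs-inj xs∉HC =
  subst (λ H → PrCond σ 1 (allIn xs) i H ≡ ℕ→ℚ (a C δ′) ÷? ℕ→ℚ ((a + b) C δ′)) (sym HC≡⁅h⁆)
    (PrCond-⁅⁆ σ equitable design a+b+1≡n (s≤s δ′≤t) i h H₀∈𝒜ᵢ H₀∩h≡∅ xs xs-inj xs≢h)
  where
  h = proj₁ (∣S∣≡1⇒S≡⁅x⁆ HC ∣HC∣≡1)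
  HC≡⁅h⁆ = proj₂ (∣S∣≡1⇒S≡⁅x⁆ HC ∣HC∣≡1)
  H₀∩h≡∅ : disjointᵇ H₀ ⁅ h ⁆ ≡ true
  H₀∩h≡∅ = subst (λ H → disjointᵇ H₀ H ≡ true) HC≡⁅h⁆ H₀∩HC≡∅
  xs≢h : ∀ j → xs j ≢ h
  xs≢h j = x∉⁅y⁆⇒x≢y (subst (xs j ∉_) HC≡⁅h⁆ (xs∉HC j))
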